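{- Let $n\geq 4$ be an integer and let $\mathcal{G}^2_n=(V,\{C_H,C_V\},R)$ be the multi-layer graph defined in the context. If two cops are played with one cop allocated to $C_H$ and the other allocated to $C_V$, then the robber player has a winning strategy.
   Context: A multi-layer graph with designated layers is $\mathcal{G}=(V,\{C_1,\dots,C_\tau\},R)$ with finite vertex set $V$, cop layers $C_i\subseteq\binom{V}{2}$ and robber layer $R\subseteq\binom{V}{2}$. Game with an allocation $(k_1,\dots,k_\tau)$: $k_i$ cops are assigned to $C_i$; cops are placed on vertices first, then the robber; turns alternate starting with the cops; on the cops' turn each cop stays or moves along one edge of its own layer; on the robber's turn it stays or moves along one edge of $R$; the cops win if some cop ever occupies the robber's vertex, the robber wins if it evades forever; perfect information. Definition of $\mathcal{G}^2_n$: $V=\{(i,j): i,j\in\{1,\dots,n\}\}$; $C_H=\{(i,j)(i,j+1): i\in[n], j\in[n-1]\}\cup\{(i,1)(i+1,1): i\in[n-1], i \text{ even}\}\cup\{(i,n)(i+1,n): i\in[n-1], i\text{ odd}\}$; $C_V=\{(i,j)(i+1,j): j\in[n], i\in[n-1]\}\cup\{(1,j)(1,j+1): j\in[n-1], j\text{ even}\}\cup\{(n,j)(n,j+1): j\in[n-1], j\text{ odd}\}$; $R=C_H\cup C_V$. -}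

module Defs where

open import Data.Nat using (ℕ; zero; suc; _%_; _≤_)
open import Data.Fin using (Fin; toℕ)
open import Data.Product using (Σ; _×_; _,_; proj₁; proj₂)
open import Data.Sum using (_⊎_)
open import Data.List using (List; []; _∷_)
open import Data.Empty using (⊥)
open import Relation.Binary.PropositionalEquality using (_≡_)
open import Relation.Nullary using (¬_)

-- The multi-layer graph G²ₙ.
-- Vertices (i , j) with i , j ∈ {1,…,n}; we represent them by Fin n × Fin n,
-- the actual (1-based) coordinate of a : Fin n being  suc (toℕ a).

V : ℕ → Set
V n = Fin n × Fin n

row col : ∀ {n} → V n → ℕ
row (i , j) = suc (toℕ i)
col (i , j) = suc (toℕ j)

Even Odd : ℕ → Set
Even i = i % 2 ≡ 0
Odd  i = i % 2 ≡ 1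

-- Oriented generating edges of C_H, on 1-based coordinates (i , j) → (i' , j').
-- Range conditions (j ∈ [n-1], i ∈ [n-1]) are automatic since both endpoints
-- are vertices.
data HEdge (n : ℕ) : ℕ → ℕ → ℕ → ℕ → Set where
  hor   : ∀ i j → HEdge n i j i (suc j)
  left  : ∀ i → Even i → HEdge n i 1 (suc i) 1
  right : ∀ i → Odd i  → HEdge n i n (suc i) n

data VEdge (n : ℕ) : ℕ → ℕ → ℕ → ℕ → Set where
  ver    : ∀ i j → VEdge n i j (suc i) j
  top    : ∀ j → Even j → VEdge n 1 j 1 (suc j)
  bottom : ∀ j → Odd j  → VEdge n n j n (suc j)

C-H : (n : ℕ) → V n → V n → Set
C-H n u v = HEdge n (row u) (col u) (row v) (col v) ⊎ HEdge n (row v) (col v) (row u) (col u)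

C-V : (n : ℕ) → V n → V n → Set
C-V n u v = VEdge n (row u) (col u) (row v) (col v) ⊎ VEdge n (row v) (col v) (row u) (col u)

R : (n : ℕ) → V n → V n → Set
R n u v = C-H n u v ⊎ C-V n u v

Move : ∀ {n} → (V n → V n → Set) → V n → V n → Set
Move E u v = u ≡ v ⊎ E u v

record State (n : ℕ) : Set where
  constructor st
  field
    copH   : V n
    copV   : V n
    robber : V n
open State public

-- A history is the list of all previous positions (most recent first).
History : ℕ → Set
History n = List (State n)

record CopStrategy (n : ℕ) : Set where
  field
    placeH : V n
    placeV : V n
    move   : History n → (s : State n) →
             Σ (V n × V n) λ c → Move (C-H n) (copH s) (proj₁ c) × Move (C-V n) (copV s) (proj₂ c)
open CopStrategy public

record RobberStrategy (n : ℕ) : Set where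
  field
    place : V n → V n → V n
    move  : History n → (s : State n) → Σ (V n) λ r → Move (R n) (robber s) r
open RobberStrategy public

initial : ∀ {n} → CopStrategy n → RobberStrategy n → State n
initial σ ρ = st (placeH σ) (placeV σ) (place ρ (placeH σ) (placeV σ))

afterCops : ∀ {n} → CopStrategy n → History n → State n → State n
afterCops σ h s = st (proj₁ (proj₁ (move σ h s))) (proj₂ (proj₁ (move σ h s))) (robber s)

round : ∀ {n} → CopStrategy n → RobberStrategy n → History n × State n → History n × State n
round σ ρ (h , s) =
  let s' = afterCops σ h s
      h' = s ∷ h
  in (s' ∷ h') , st (copH s') (copV s') (proj₁ (RobberStrategy.move ρ h' s'))

-- (history , position) at the start of round k (cops to move)
play : ∀ {n} → CopStrategy n → RobberStrategy n → ℕ → History n × State n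
play σ ρ zero    = [] , initial σ ρ
play σ ρ (suc k) = round σ ρ (play σ ρ k)

-- position at the start of round k, and right after the cops' move in round k
pos : ∀ {n} → CopStrategy n → RobberStrategy n → ℕ → State n
pos σ ρ k = proj₂ (play σ ρ k)

pos' : ∀ {n} → CopStrategy n → RobberStrategy n → ℕ → State n
pos' σ ρ k = afterCops σ (proj₁ (play σ ρ k)) (proj₂ (play σ ρ k))

Captured : ∀ {n} → State n → Set
Captured s = copH s ≡ robber s ⊎ copV s ≡ robber s

Evades : ∀ {n} → CopStrategy n → RobberStrategy n → Set
Evades σ ρ = ∀ k → ¬ Captured (pos σ ρ k) × ¬ Captured (pos' σ ρ k)

RobberWins : ℕ → Set
RobberWins n = Σ (RobberStrategy n) λ ρ → (σ : CopStrategy n) → Evades σ ρ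

module Submission where

-- The robber keeps an invariant on the positions of the C_H cop, the C_V cop and itself
-- that rules out capture on the cops' next move, and that it can restore after any cop
-- move by a single step; its strategy is to step to any position satisfying it.
--
-- For n ≥ 5 the invariant is: the robber is off the boundary, out of reach of both cops,
-- and the C_H cop is not in its row while the C_V cop is in its column. Away from columns
-- 1 and n a cop on C_H only moves along its row, and dually for C_V. So if after the cops'
-- move both are in line with the robber, one of them stands on a boundary line, and the
-- robber escapes it by stepping along the other cop's line to an interior neighbour two
-- away from that boundary line; if only one cop is in line, it steps off that line.
--
-- For n = 4 the invariant is the robber's winning region, checked by evaluation.

open import Defs
open import Data.Bool using (Bool; T; not; _∨_; true; false)
open import Data.Bool.ListAction using (all; any)
open import Data.Bool.Properties using (T-≡)
open import Data.Empty using (⊥-elim)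
open import Data.Fin using (Fin; toℕ; fromℕ<)
open import Data.Fin.Properties using (any?; toℕ-fromℕ<) renaming (_≟_ to _≟ᶠ_)
open import Data.List using (List; allFin; cartesianProduct)
open import Data.List.Membership.Propositional.Properties using (∈-allFin; ∈-cartesianProduct⁺)
open import Data.List.Relation.Unary.All as All using ()
open import Data.List.Relation.Unary.All.Properties using (all⁺)
open import Data.List.Relation.Unary.Any using (satisfied)
open import Data.List.Relation.Unary.Any.Properties using (any⁻)
open import Data.Nat using (ℕ; zero; suc; _+_; _≤_; _<_; s≤s; s≤s⁻¹; z≤n; _≟_; _≤?_; _<?_; ∣_-_∣; _%_)
open import Data.Nat.Properties
  using (≤-refl; ≤-trans; ≤-reflexive; <⇒≤; n<1+n; <-trans; <-irrefl; <⇒≱; ≮⇒≥; ≤∧≢⇒<; 1+n≢n; ∣-∣-comm; ∣n-n∣≡0)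
open import Data.Product using (Σ; ∃; _×_; _,_; proj₁; proj₂)
open import Data.Product.Properties using (≡-dec)
open import Data.Sum using (_⊎_; inj₁; inj₂)
open import Function using (_∘_; Equivalence)
open import Relation.Binary.Definitions using (Decidable; DecidableEquality)
open import Relation.Binary.PropositionalEquality using (_≡_; _≢_; refl; sym; trans; cong; subst; subst₂; ≢-sym)
open import Relation.Nullary using (¬_; Dec; yes; no; does)
open import Relation.Nullary.Decidable using (map′; ¬?; T?; _×-dec_; _⊎-dec_)
open import Relation.Unary using () renaming (Decidable to Decidable₁)

hedge? : ∀ n a b a' b' → Dec (HEdge n a b a' b')
hedge? n a b a' b' = map′ from to
  (    (a' ≟ a ×-dec b' ≟ suc b)
  ⊎-dec (b ≟ 1 ×-dec b' ≟ 1 ×-dec a' ≟ suc a ×-dec a % 2 ≟ 0)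
  ⊎-dec (b ≟ n ×-dec b' ≟ n ×-dec a' ≟ suc a ×-dec a % 2 ≟ 1))
  where
  Shape : ℕ → ℕ → ℕ → ℕ → Set
  Shape a b a' b' = (a' ≡ a × b' ≡ suc b)
                  ⊎ (b ≡ 1 × b' ≡ 1 × a' ≡ suc a × Even a)
                  ⊎ (b ≡ n × b' ≡ n × a' ≡ suc a × Odd a)

  from : ∀ {a b a' b'} → Shape a b a' b' → HEdge n a b a' b'
  from (inj₁ (refl , refl))                   = hor _ _
  from (inj₂ (inj₁ (refl , refl , refl , e))) = left _ e
  from (inj₂ (inj₂ (refl , refl , refl , o))) = right _ o

  to : ∀ {a b a' b'} → HEdge n a b a' b' → Shape a b a' b'
  to (hor i j)   = inj₁ (refl , refl)
  to (left i e)  = inj₂ (inj₁ (refl , refl , refl , e))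
  to (right i o) = inj₂ (inj₂ (refl , refl , refl , o))

module _ {n : ℕ} where

  vedge⇒hedge : ∀ {i j i' j'} → VEdge n i j i' j' → HEdge n j i j' i'
  vedge⇒hedge (ver i j)    = hor j i
  vedge⇒hedge (top j e)    = left j e
  vedge⇒hedge (bottom j o) = right j o

  hedge⇒vedge : ∀ {i j i' j'} → HEdge n j i j' i' → VEdge n i j i' j'
  hedge⇒vedge (hor j i)   = ver i j
  hedge⇒vedge (left j e)  = top j e
  hedge⇒vedge (right j o) = bottom j o

vedge? : ∀ n a b a' b' → Dec (VEdge n a b a' b')
vedge? n a b a' b' = map′ hedge⇒vedge vedge⇒hedge (hedge? n b a b' a')

module _ {n : ℕ} where

  _≟ᵥ_ : DecidableEquality (V n)
  _≟ᵥ_ = ≡-dec _≟ᶠ_ _≟ᶠ_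

  move? : {E : V n → V n → Set} → Decidable E → Decidable (Move E)
  move? E? u v = (u ≟ᵥ v) ⊎-dec E? u v

  C-H? : Decidable (C-H n)
  C-H? u v = hedge? n _ _ _ _ ⊎-dec hedge? n _ _ _ _

  C-V? : Decidable (C-V n)
  C-V? u v = vedge? n _ _ _ _ ⊎-dec vedge? n _ _ _ _

  R? : Decidable (R n)
  R? u v = C-H? u v ⊎-dec C-V? u v

  any-vertex? : {P : V n → Set} → Decidable₁ P → Dec (∃ P)
  any-vertex? P? = map′ (λ (i , j , p) → (i , j) , p) (λ ((i , j) , p) → i , j , p)
                        (any? λ i → any? λ j → P? (i , j))

-- A robber strategy from an invariant

record EvasionInvariant (n : ℕ) : Set₁ where
  field
    Safe        : V n → V n → V n → Set
    safe?       : ∀ h v r → Dec (Safe h v r)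
    outOfReachH : ∀ {h v r} → Safe h v r → ¬ Move (C-H n) h r
    outOfReachV : ∀ {h v r} → Safe h v r → ¬ Move (C-V n) v r
    evade       : ∀ {h v r h' v'} → Safe h v r → Move (C-H n) h h' → Move (C-V n) v v' →
                  ∃ λ r' → Move (R n) r r' × Safe h' v' r'
    start       : ∀ h v → ∃ (Safe h v)

module _ {n : ℕ} (I : EvasionInvariant n) where
  open EvasionInvariant I

  safeMove : (h v r : V n) → Σ (V n) (Move (R n) r)
  safeMove h v r with any-vertex? (λ r' → move? R? r r' ×-dec safe? h v r')
  ... | yes (r' , m , _) = r' , m
  ... | no _             = r , inj₁ refl

  safeMove-safe : ∀ {h v r h' v'} → Safe h v r → Move (C-H n) h h' → Move (C-V n) v v' →
                  Safe h' v' (proj₁ (safeMove h' v' r))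
  safeMove-safe {r = r} {h'} {v'} s mh mv with any-vertex? (λ r' → move? R? r r' ×-dec safe? h' v' r')
  ... | yes (_ , _ , s') = s'
  ... | no none          = ⊥-elim (none (evade s mh mv))

  uncaught : ∀ {h v r h' v'} → Safe h v r → Move (C-H n) h h' → Move (C-V n) v v' →
             ¬ Captured (st h' v' r)
  uncaught s mh _ (inj₁ h'≡r) = outOfReachH s (subst (Move (C-H n) _) h'≡r mh)
  uncaught s _ mv (inj₂ v'≡r) = outOfReachV s (subst (Move (C-V n) _) v'≡r mv)

  safeStrategy : RobberStrategy n
  safeStrategy = record
    { place = λ h v → proj₁ (start h v)
    ; move  = λ _ s → safeMove (copH s) (copV s) (robber s)
    }

  module _ (σ : CopStrategy n) where

    safe-at : ∀ k → let s = pos σ safeStrategy k in Safe (copH s) (copV s) (robber s)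
    safe-at zero = proj₂ (start (placeH σ) (placeV σ))
    safe-at (suc k) with play σ safeStrategy k | safe-at k
    ... | hist , st h v r | s = safeMove-safe s (proj₁ moves) (proj₂ moves)
      where moves = proj₂ (CopStrategy.move σ hist (st h v r))

    evades : Evades σ safeStrategy
    evades k with play σ safeStrategy k | safe-at k
    ... | hist , st h v r | s = uncaught s (inj₁ refl) (inj₁ refl) , uncaught s (proj₁ moves) (proj₂ moves)
      where moves = proj₂ (CopStrategy.move σ hist (st h v r))

  robberWins : RobberWins n
  robberWins = safeStrategy , evades

Adjacent : ℕ → ℕ → Set
Adjacent x x' = x' ≡ suc x ⊎ x ≡ suc x'

OnBoundary : ℕ → ℕ → Set
OnBoundary n x = x ≡ 1 ⊎ x ≡ n

Interior : ℕ → ℕ → Set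
Interior n x = 1 < x × x < n

interior⇒¬onBoundary : ∀ {n x} → Interior n x → ¬ OnBoundary n x
interior⇒¬onBoundary (1<x , _) (inj₁ refl) = <-irrefl refl 1<x
interior⇒¬onBoundary (_ , x<n) (inj₂ refl) = <-irrefl refl x<n

adjacent⇒≢ : ∀ {x x'} → Adjacent x x' → x ≢ x'
adjacent⇒≢ (inj₁ refl) = ≢-sym 1+n≢n
adjacent⇒≢ (inj₂ refl) = 1+n≢n

∣m-1+m∣≡1 : ∀ m → ∣ m - suc m ∣ ≡ 1
∣m-1+m∣≡1 zero    = refl
∣m-1+m∣≡1 (suc m) = ∣m-1+m∣≡1 m

adjacent⇒∣-∣≡1 : ∀ {x x'} → Adjacent x x' → ∣ x - x' ∣ ≡ 1
adjacent⇒∣-∣≡1 {x}      (inj₁ refl) = ∣m-1+m∣≡1 x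
adjacent⇒∣-∣≡1 {x' = x'} (inj₂ refl) = trans (∣-∣-comm (suc x') x') (∣m-1+m∣≡1 x')

2+m≤n⇒2≤∣m-n∣ : ∀ {m n} → 2 + m ≤ n → 2 ≤ ∣ m - n ∣
2+m≤n⇒2≤∣m-n∣ {zero}  2≤n      = 2≤n
2+m≤n⇒2≤∣m-n∣ {suc m} (s≤s le) = 2+m≤n⇒2≤∣m-n∣ {m} le

2+m≤n⇒2≤∣n-m∣ : ∀ {m n} → 2 + m ≤ n → 2 ≤ ∣ n - m ∣
2+m≤n⇒2≤∣n-m∣ {m} {n} le = subst (2 ≤_) (∣-∣-comm m n) (2+m≤n⇒2≤∣m-n∣ le)

module _ {n : ℕ} where

  awayFrom1 : ∀ {x} → 5 ≤ n → Interior n x → ∃ λ x' → Adjacent x x' × Interior n x' × 2 < x'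
  awayFrom1 {1} _ (s≤s () , _)
  awayFrom1 {2} 5≤n _ = 3 , inj₁ refl , (s≤s (s≤s z≤n) , <⇒≤ 5≤n) , ≤-refl
  awayFrom1 {suc (suc (suc p))} 5≤n (_ , x<n) with suc (suc (suc (suc p))) <? n
  ... | yes 1+x<n = suc (suc (suc (suc p))) , inj₁ refl , (s≤s (s≤s z≤n) , 1+x<n) , s≤s (s≤s (s≤s z≤n))
  ... | no 1+x≮n  = suc (suc p) , inj₂ refl , (s≤s (s≤s z≤n) , <-trans (n<1+n _) x<n) ,
                    s≤s (s≤s (s≤s⁻¹ (s≤s⁻¹ (s≤s⁻¹ (s≤s⁻¹ (≤-trans 5≤n (≮⇒≥ 1+x≮n)))))))

  awayFromN : ∀ {x} → 5 ≤ n → Interior n x → ∃ λ x' → Adjacent x x' × Interior n x' × suc x' < n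
  awayFromN {1} _ (s≤s () , _)
  awayFromN {2} 5≤n _ = 3 , inj₁ refl , (s≤s (s≤s z≤n) , <⇒≤ 5≤n) , 5≤n
  awayFromN {suc (suc (suc p))} _ (_ , x<n) =
    suc (suc p) , inj₂ refl , (s≤s (s≤s z≤n) , <-trans (n<1+n _) x<n) , x<n

Escape : ℕ → ℕ → ℕ → Set
Escape n x c = ∃ λ x' → Adjacent x x' × Interior n x' × (OnBoundary n c → 2 ≤ ∣ c - x' ∣)

module _ {n : ℕ} where

  escape : ∀ {x} → 5 ≤ n → Interior n x → ∀ c → Escape n x c
  escape 5≤n ix c with c ≟ 1
  ... | yes refl =
    let x' , adj , ix' , 2<x' = awayFrom1 5≤n ix in
    x' , adj , ix' , λ _ → 2+m≤n⇒2≤∣m-n∣ 2<x'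
  ... | no c≢1 =
    let x' , adj , ix' , 1+x'<n = awayFromN 5≤n ix in
    x' , adj , ix' , λ { (inj₁ c≡1) → ⊥-elim (c≢1 c≡1) ; (inj₂ refl) → 2+m≤n⇒2≤∣n-m∣ 1+x'<n }

  avoid : 4 ≤ n → ∀ a → ∃ λ x → Interior n x × a ≢ x
  avoid 4≤n a with a ≟ 2
  ... | yes refl = 3 , (s≤s (s≤s z≤n) , 4≤n) , λ ()
  ... | no a≢2   = 2 , (s≤s (s≤s z≤n) , ≤-trans (s≤s (s≤s (s≤s z≤n))) 4≤n) , a≢2

module _ {n : ℕ} where

  transpose : V n → V n
  transpose (i , j) = j , i

  transpose-C-V : ∀ {u u'} → Move (C-V n) u u' → Move (C-H n) (transpose u) (transpose u')
  transpose-C-V (inj₁ refl)     = inj₁ refl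
  transpose-C-V (inj₂ (inj₁ e)) = inj₂ (inj₁ (vedge⇒hedge e))
  transpose-C-V (inj₂ (inj₂ e)) = inj₂ (inj₂ (vedge⇒hedge e))

  hedge-shape : ∀ {a b a' b'} → HEdge n a b a' b' → a' ≡ a × b' ≡ suc b ⊎ b' ≡ b × OnBoundary n b
  hedge-shape (hor i j)   = inj₁ (refl , refl)
  hedge-shape (left i _)  = inj₂ (refl , inj₁ refl)
  hedge-shape (right i _) = inj₂ (refl , inj₂ refl)

  inRow : ∀ {u u'} → Move (C-H n) u u' → ¬ OnBoundary n (col u') → row u' ≡ row u × ∣ col u - col u' ∣ ≤ 1
  inRow {u} (inj₁ refl) _ = refl , subst (_≤ 1) (sym (∣n-n∣≡0 (col u))) z≤n
  inRow (inj₂ (inj₁ e)) ¬bd with hedge-shape e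
  ... | inj₁ (p , q)  = p , ≤-reflexive (adjacent⇒∣-∣≡1 (inj₁ q))
  ... | inj₂ (q , bd) = ⊥-elim (¬bd (subst (OnBoundary n) (sym q) bd))
  inRow (inj₂ (inj₂ e)) ¬bd with hedge-shape e
  ... | inj₁ (p , q)  = sym p , ≤-reflexive (adjacent⇒∣-∣≡1 (inj₂ q))
  ... | inj₂ (_ , bd) = ⊥-elim (¬bd bd)

  Apart : V n → V n → Set
  Apart h r = row h ≢ row r ⊎ 2 ≤ ∣ col h - col r ∣

  apart⇒unreachable : ∀ {h r} → ¬ OnBoundary n (col r) → Apart h r → ¬ Move (C-H n) h r
  apart⇒unreachable ¬bd apart m with inRow m ¬bd | apart
  ... | p , _    | inj₁ h≢r = h≢r (sym p)
  ... | _ , near | inj₂ far = <⇒≱ far near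

  verticalMove : ∀ {r r'} → Adjacent (row r) (row r') → col r' ≡ col r → Move (R n) r r'
  verticalMove {r}      (inj₁ p) q = inj₂ (inj₂ (inj₁ (subst₂ (VEdge n (row r) (col r)) (sym p) (sym q) (ver _ _))))
  verticalMove {r' = r'} (inj₂ p) q = inj₂ (inj₂ (inj₂ (subst₂ (VEdge n (row r') (col r')) (sym p) q (ver _ _))))

  horizontalMove : ∀ {r r'} → Adjacent (col r) (col r') → row r' ≡ row r → Move (R n) r r'
  horizontalMove {r}      (inj₁ p) q = inj₂ (inj₁ (inj₁ (subst₂ (HEdge n (row r) (col r)) (sym q) (sym p) (hor _ _))))
  horizontalMove {r' = r'} (inj₂ p) q = inj₂ (inj₁ (inj₂ (subst₂ (HEdge n (row r') (col r')) q (sym p) (hor _ _))))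

  fromInterior : ∀ {x} → Interior n x → Σ (Fin n) λ i → suc (toℕ i) ≡ x
  fromInterior {suc x} (_ , x<n) = fromℕ< x<n′ , cong suc (toℕ-fromℕ< x<n′)
    where x<n′ = <-trans (n<1+n x) x<n

-- Boards of size at least five

module _ {n : ℕ} where

  SafeInterior : V n → V n → V n → Set
  SafeInterior h v r = Interior n (row r) × Interior n (col r) ×
                       Apart h r × Apart (transpose v) (transpose r) × (row h ≢ row r ⊎ col v ≢ col r)

  moveVertically : ∀ {r h' v' x'} → Interior n (col r) → row h' ≡ row r → Adjacent (row r) x' → Interior n x' →
                   col v' ≢ col r ⊎ 2 ≤ ∣ row v' - x' ∣ → ∃ λ r' → Move (R n) r r' × SafeInterior h' v' r'
  moveVertically {i , j} iy a'≡x adj ix' apartV with fromInterior ix'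
  ... | i' , refl = (i' , j) , verticalMove adj refl , ix' , iy , inj₁ leftRow , apartV , inj₁ leftRow
    where leftRow = λ a'≡x' → adjacent⇒≢ adj (trans (sym a'≡x) a'≡x')

  moveHorizontally : ∀ {r h' v' y'} → Interior n (row r) → col v' ≡ col r → Adjacent (col r) y' → Interior n y' →
                     row h' ≢ row r ⊎ 2 ≤ ∣ col h' - y' ∣ → ∃ λ r' → Move (R n) r r' × SafeInterior h' v' r'
  moveHorizontally {i , j} ix d'≡y adj iy' apartH with fromInterior iy'
  ... | j' , refl = (i , j') , horizontalMove adj refl , ix , iy' , apartH , inj₁ leftColumn , inj₂ leftColumn
    where leftColumn = λ d'≡y' → adjacent⇒≢ adj (trans (sym d'≡y) d'≡y')

  largeBoard : 5 ≤ n → EvasionInvariant n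
  largeBoard 5≤n = record
    { Safe        = SafeInterior
    ; safe?       = λ h v r → interior? (row r) ×-dec interior? (col r) ×-dec apart? h r ×-dec
                              apart? (transpose v) (transpose r) ×-dec (¬? (row h ≟ row r) ⊎-dec ¬? (col v ≟ col r))
    ; outOfReachH = λ (_ , iy , apartH , _) → apart⇒unreachable (interior⇒¬onBoundary iy) apartH
    ; outOfReachV = λ (ix , _ , _ , apartV , _) → apart⇒unreachable (interior⇒¬onBoundary ix) apartV ∘ transpose-C-V
    ; evade       = evade
    ; start       = start
    }
    where
    interior? : ∀ x → Dec (Interior n x)
    interior? x = 1 <? x ×-dec x <? n

    apart? : ∀ h r → Dec (Apart h r)
    apart? h r = ¬? (row h ≟ row r) ⊎-dec 2 ≤? ∣ col h - col r ∣

    onBoundary? : ∀ x → Dec (OnBoundary n x)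
    onBoundary? x = x ≟ 1 ⊎-dec x ≟ n

    evade : ∀ {h v r h' v'} → SafeInterior h v r → Move (C-H n) h h' → Move (C-V n) v v' →
            ∃ λ r' → Move (R n) r r' × SafeInterior h' v' r'
    evade {h} {v} {r} {h'} {v'} (ix , iy , _ , _ , notAligned) mh mv
      with row h' ≟ row r | col v' ≟ col r
    ... | no a'≢x | no d'≢y = r , inj₁ refl , ix , iy , inj₁ a'≢x , inj₁ d'≢y , inj₁ a'≢x
    ... | yes a'≡x | no d'≢y =
      let x' , adj , ix' , _ = awayFromN 5≤n ix in moveVertically {h' = h'} {v'} iy a'≡x adj ix' (inj₁ d'≢y)
    ... | no a'≢x | yes d'≡y =
      let y' , adj , iy' , _ = awayFromN 5≤n iy in moveHorizontally {h' = h'} {v'} ix d'≡y adj iy' (inj₁ a'≢x)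
    ... | yes a'≡x | yes d'≡y with onBoundary? (row v') | onBoundary? (col h')
    ...   | yes bd | _ =
      let x' , adj , ix' , far = escape 5≤n ix (row v') in moveVertically {h' = h'} {v'} iy a'≡x adj ix' (inj₂ (far bd))
    ...   | no _ | yes bd =
      let y' , adj , iy' , far = escape 5≤n iy (col h') in moveHorizontally {h' = h'} {v'} ix d'≡y adj iy' (inj₂ (far bd))
    ...   | no ¬bdV | no ¬bdH with notAligned
    ...     | inj₁ a≢x = ⊥-elim (a≢x (trans (sym (proj₁ (inRow mh ¬bdH))) a'≡x))
    ...     | inj₂ d≢y = ⊥-elim (d≢y (trans (sym (proj₁ (inRow (transpose-C-V mv) ¬bdV))) d'≡y))

    start : ∀ h v → ∃ (SafeInterior h v)
    start h v with avoid (<⇒≤ 5≤n) (row h) | avoid (<⇒≤ 5≤n) (col v)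
    ... | x , ix , a≢x | y , iy , d≢y with fromInterior ix | fromInterior iy
    ...   | i , refl | j , refl = (i , j) , ix , iy , inj₁ a≢x , inj₁ d≢y , inj₁ a≢x

-- The 4 × 4 board

vertices : ∀ {n} → List (V n)
vertices {n} = cartesianProduct (allFin n) (allFin n)

module _ {n : ℕ} where

  all-vertices : (p : V n → Bool) → T (all p vertices) → ∀ u → T (p u)
  all-vertices p t (i , j) = All.lookup (all⁺ p vertices t) (∈-cartesianProduct⁺ (∈-allFin i) (∈-allFin j))

  any-vertex : (p : V n → Bool) → T (any p vertices) → ∃ λ u → T (p u)
  any-vertex p t = satisfied (any⁻ p vertices t)

  -- Stated with ≡ true so that a closed instance is proved by refl, which
  -- evaluates the check once; unifying against T of it would evaluate it repeatedly.
  all-vertices² : (p : V n → V n → Bool) → all (λ u → all (p u) vertices) vertices ≡ true →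
                  ∀ u v → T (p u v)
  all-vertices² p eq u = all-vertices (p u) (all-vertices (λ u → all (p u) vertices) (Equivalence.from T-≡ eq) u)

  all-vertices³ : (p : V n → V n → V n → Bool) →
                  all (λ u → all (λ v → all (p u v) vertices) vertices) vertices ≡ true → ∀ u v w → T (p u v w)
  all-vertices³ p eq u v = all-vertices (p u v) (all-vertices (λ v → all (p u v) vertices)
                             (all-vertices (λ u → all (λ v → all (p u v) vertices) vertices) (Equivalence.from T-≡ eq) u) v)

witness : {A : Set} (a? : Dec A) → T (does a?) → A
witness (yes a) _ = a

_⇒_ : {A : Set} → Dec A → Bool → Bool
a? ⇒ b = not (does a?) ∨ b

⇒-elim : ∀ {A : Set} {b} (a? : Dec A) → T (a? ⇒ b) → A → T b
⇒-elim (yes _) t _ = t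
⇒-elim (no ¬a) _ a = ⊥-elim (¬a a)

-- The positions out of reach of both cops from which the cops can nevertheless
-- force a capture, found by computing the robber's winning region.
trapped4 : ℕ × ℕ → ℕ × ℕ → ℕ × ℕ → Bool
trapped4 (1 , 1) (3 , 4) (1 , 4) = true
trapped4 (1 , 1) (4 , 4) (1 , 4) = true
trapped4 (1 , 2) (3 , 4) (1 , 4) = true
trapped4 (1 , 2) (4 , 4) (1 , 4) = true
trapped4 (1 , 3) (3 , 1) (1 , 1) = true
trapped4 (1 , 3) (4 , 1) (1 , 1) = true
trapped4 (1 , 4) (3 , 1) (1 , 1) = true
trapped4 (1 , 4) (4 , 1) (1 , 1) = true
trapped4 (2 , 1) (2 , 2) (1 , 3) = true
trapped4 (2 , 1) (2 , 2) (4 , 1) = true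
trapped4 (2 , 1) (3 , 2) (1 , 3) = true
trapped4 (2 , 1) (3 , 2) (4 , 1) = true
trapped4 (2 , 2) (1 , 2) (1 , 4) = true
trapped4 (2 , 2) (1 , 2) (3 , 1) = true
trapped4 (2 , 2) (1 , 3) (1 , 4) = true
trapped4 (2 , 2) (2 , 2) (1 , 3) = true
trapped4 (2 , 2) (2 , 2) (1 , 4) = true
trapped4 (2 , 2) (2 , 2) (3 , 1) = true
trapped4 (2 , 2) (2 , 2) (4 , 1) = true
trapped4 (2 , 2) (2 , 3) (1 , 4) = true
trapped4 (2 , 2) (3 , 2) (1 , 3) = true
trapped4 (2 , 2) (3 , 2) (1 , 4) = true
trapped4 (2 , 2) (3 , 2) (3 , 1) = true
trapped4 (2 , 2) (3 , 2) (4 , 1) = true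
trapped4 (2 , 2) (3 , 3) (1 , 4) = true
trapped4 (2 , 2) (4 , 2) (1 , 4) = true
trapped4 (2 , 2) (4 , 2) (3 , 1) = true
trapped4 (2 , 3) (1 , 2) (1 , 4) = true
trapped4 (2 , 3) (1 , 2) (3 , 1) = true
trapped4 (2 , 3) (1 , 3) (1 , 4) = true
trapped4 (2 , 3) (2 , 2) (1 , 3) = true
trapped4 (2 , 3) (2 , 2) (1 , 4) = true
trapped4 (2 , 3) (2 , 2) (3 , 1) = true
trapped4 (2 , 3) (2 , 2) (4 , 1) = true
trapped4 (2 , 3) (2 , 3) (1 , 4) = true
trapped4 (2 , 3) (3 , 2) (1 , 3) = true
trapped4 (2 , 3) (3 , 2) (1 , 4) = true
trapped4 (2 , 3) (3 , 2) (3 , 1) = true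
trapped4 (2 , 3) (3 , 2) (4 , 1) = true
trapped4 (2 , 3) (3 , 3) (1 , 4) = true
trapped4 (2 , 3) (4 , 2) (1 , 4) = true
trapped4 (2 , 3) (4 , 2) (3 , 1) = true
trapped4 (2 , 4) (2 , 2) (1 , 3) = true
trapped4 (2 , 4) (2 , 2) (4 , 1) = true
trapped4 (2 , 4) (3 , 2) (1 , 3) = true
trapped4 (2 , 4) (3 , 2) (4 , 1) = true
trapped4 (3 , 1) (2 , 2) (4 , 1) = true
trapped4 (3 , 1) (3 , 2) (4 , 1) = true
trapped4 (3 , 2) (2 , 2) (4 , 1) = true
trapped4 (3 , 2) (2 , 3) (4 , 4) = true
trapped4 (3 , 2) (3 , 2) (4 , 1) = true
trapped4 (3 , 2) (3 , 3) (4 , 4) = true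
trapped4 (3 , 3) (2 , 2) (4 , 1) = true
trapped4 (3 , 3) (2 , 3) (4 , 4) = true
trapped4 (3 , 3) (3 , 2) (4 , 1) = true
trapped4 (3 , 3) (3 , 3) (4 , 4) = true
trapped4 (4 , 1) (1 , 4) (4 , 4) = true
trapped4 (4 , 1) (2 , 4) (4 , 4) = true
trapped4 (4 , 2) (1 , 4) (4 , 4) = true
trapped4 (4 , 2) (2 , 4) (4 , 4) = true
trapped4 (4 , 3) (1 , 1) (4 , 1) = true
trapped4 (4 , 3) (2 , 1) (4 , 1) = true
trapped4 (4 , 4) (1 , 1) (4 , 1) = true
trapped4 (4 , 4) (2 , 1) (4 , 1) = true
trapped4 _ _ _ = false

Safe4 : V 4 → V 4 → V 4 → Set
Safe4 h v r = ¬ Move (C-H 4) h r × ¬ Move (C-V 4) v r × ¬ T (trapped4 (row h , col h) (row v , col v) (row r , col r))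

safe4? : ∀ h v r → Dec (Safe4 h v r)
safe4? h v r = ¬? (move? C-H? h r) ×-dec ¬? (move? C-V? v r) ×-dec ¬? (T? _)

escapes4 : (h' v' r : V 4) → Bool
escapes4 h' v' r = any (λ r' → does (move? R? r r' ×-dec safe4? h' v' r')) vertices

survivesV4 : (h' v r : V 4) → Bool
survivesV4 h' v r = all (λ v' → move? C-V? v v' ⇒ escapes4 h' v' r) vertices

survives4 : (h v r : V 4) → Bool
survives4 h v r = safe4? h v r ⇒ all (λ h' → move? C-H? h h' ⇒ survivesV4 h' v r) vertices

survives4-everywhere : ∀ h v r → T (survives4 h v r)
survives4-everywhere = all-vertices³ survives4 refl

placeable4 : (h v : V 4) → Bool
placeable4 h v = any (λ r → does (safe4? h v r)) vertices

placeable4-everywhere : ∀ h v → T (placeable4 h v)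
placeable4-everywhere = all-vertices² placeable4 refl

smallBoard : EvasionInvariant 4
smallBoard = record
  { Safe        = Safe4
  ; safe?       = safe4?
  ; outOfReachH = proj₁
  ; outOfReachV = proj₁ ∘ proj₂
  ; evade       = evade4
  ; start       = start4
  }
  where
  evade4 : ∀ {h v r h' v'} → Safe4 h v r → Move (C-H 4) h h' → Move (C-V 4) v v' →
           ∃ λ r' → Move (R 4) r r' × Safe4 h' v' r'
  evade4 {h} {v} {r} {h'} {v'} s mh mv =
    let afterH = all-vertices (λ h' → move? C-H? h h' ⇒ survivesV4 h' v r)
                   (⇒-elim (safe4? h v r) (survives4-everywhere h v r) s) h'
        afterV = all-vertices (λ v' → move? C-V? v v' ⇒ escapes4 h' v' r)
                   (⇒-elim (move? C-H? h h') afterH mh) v'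
        r' , t = any-vertex (λ r' → does (move? R? r r' ×-dec safe4? h' v' r'))
                   (⇒-elim (move? C-V? v v') afterV mv)
    in r' , witness (move? R? r r' ×-dec safe4? h' v' r') t

  start4 : ∀ h v → ∃ (Safe4 h v)
  start4 h v =
    let r , t = any-vertex (λ r → does (safe4? h v r)) (placeable4-everywhere h v)
    in r , witness (safe4? h v r) t

lemma3p3 : (n : ℕ) → 4 ≤ n → RobberWins n
lemma3p3 n 4≤n with n ≟ 4
... | yes refl = robberWins smallBoard
... | no n≢4   = robberWins (largeBoard (≤∧≢⇒< 4≤n (≢-sym n≢4)))
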